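{- For every set $\{i,j,k,l\}$ of four distinct elements of $\{1,\dots,m\}$, $$\frac{\partial\mathcal P_m}{\partial y_{ijk}}-\frac{\partial\mathcal P_m}{\partial y_{ijl}}=\frac{\partial\mathcal P_m}{\partial y_{jkl}}-\frac{\partial\mathcal P_m}{\partial y_{ikl}}.$$
   Context: Let $y_{ijk}$ ($i,j,k\in\{1,\dots,m\}$) be indeterminates, totally antisymmetric in their indices ($y_{ijk}=-y_{jik}=y_{jki}$, $y_{iij}=0$); the independent variables are $y_{abc}$ with $a<b<c$, and for arbitrary distinct $i,j,k$ one sets $\partial/\partial y_{ijk}=\epsilon\,\partial/\partial y_{abc}$ where $y_{ijk}=\epsilon y_{abc}$, $\epsilon=\pm1$, $a<b<c$. Let $\Lambda=(\lambda_{ij})_{1\le i,j\le m}$ with $\lambda_{ij}=\sum_k y_{ijk}$. The Pfaffian-tree polynomial is $\mathcal P_m=(-1)^{p-1}\operatorname{Pf}(\Lambda^{(p)})$, where $\Lambda^{(p)}$ is $\Lambda$ with the $p$th row and column removed (independent of $p$; Pfaffian of an odd-size matrix is $0$). -}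

module Defs where

open import Data.Nat using (ℕ; zero; suc)
open import Data.Integer using (ℤ; 0ℤ; 1ℤ; -1ℤ) renaming (_+_ to _+ℤ_; _*_ to _*ℤ_; -_ to -ℤ_)
open import Data.Fin using (Fin; zero; suc; toℕ; punchIn; _<?_)
open import Data.Fin.Properties using (_≟_)
open import Data.Bool using (Bool; true; false; if_then_else_; _∧_)
open import Relation.Nullary using (Dec; yes; no; ¬_)
open import Relation.Nullary.Decidable using (⌊_⌋)
open import Relation.Binary.PropositionalEquality using (_≡_)

-- Polynomial expressions with integer coefficients in the indeterminates
-- var a b c  (intended: a < b < c, i.e. the independent variables y_abc).
data Expr (m : ℕ) : Set where
  con : ℤ → Expr m
  var : Fin m → Fin m → Fin m → Expr m
  _⊕_ : Expr m → Expr m → Expr m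
  _⊗_ : Expr m → Expr m → Expr m
  ⊝_  : Expr m → Expr m

infixl 6 _⊕_ _⊖_
infixl 7 _⊗_

_⊖_ : ∀ {m} → Expr m → Expr m → Expr m
e ⊖ f = e ⊕ (⊝ f)

eval : ∀ {m} → (Fin m → Fin m → Fin m → ℤ) → Expr m → ℤ
eval ρ (con c)     = c
eval ρ (var a b c) = ρ a b c
eval ρ (e ⊕ f)     = eval ρ e +ℤ eval ρ f
eval ρ (e ⊗ f)     = eval ρ e *ℤ eval ρ f
eval ρ (⊝ e)       = -ℤ eval ρ e

-- Equality in the polynomial ring ℤ[y]: two expressions denote the same
-- polynomial iff they agree under every integer assignment (ℤ is an
-- infinite integral domain).
_≐_ : ∀ {m} → Expr m → Expr m → Set
_≐_ {m} e f = (ρ : Fin m → Fin m → Fin m → ℤ) → eval ρ e ≡ eval ρ f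

infix 4 _≐_

D : ∀ {m} → Fin m → Fin m → Fin m → Expr m → Expr m
D a b c (con x) = con 0ℤ
D a b c (var a' b' c') with a ≟ a' | b ≟ b' | c ≟ c'
... | yes _ | yes _ | yes _ = con 1ℤ
... | _     | _     | _     = con 0ℤ
D a b c (e ⊕ f) = D a b c e ⊕ D a b c f
D a b c (e ⊗ f) = (D a b c e ⊗ f) ⊕ (e ⊗ D a b c f)
D a b c (⊝ e)   = ⊝ (D a b c e)

-- Sorting a triple of indices: the sign ε and the sorted triple (a<b<c)
-- with y_ijk = ε y_abc; ε = 0 if two indices coincide.
data Sgn : Set where
  plus minus nil : Sgn

record Sorted (m : ℕ) : Set where
  constructor sorted
  field
    sgn : Sgn
    fst snd thd : Fin m

lt : ∀ {m} → Fin m → Fin m → Bool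
lt x y = ⌊ x <? y ⌋

eqb : ∀ {m} → Fin m → Fin m → Bool
eqb x y = ⌊ x ≟ y ⌋

sort3 : ∀ {m} → Fin m → Fin m → Fin m → Sorted m
sort3 i j k with eqb i j | eqb j k | eqb i k
... | false | false | false = go (lt i j) (lt j k) (lt i k)
  where
  go : Bool → Bool → Bool → Sorted _
  go true  true  _     = sorted plus  i j k
  go true  false true  = sorted minus i k j
  go true  false false = sorted plus  k i j
  go false true  true  = sorted minus j i k
  go false true  false = sorted plus  j k i
  go false false _     = sorted minus k j i
... | _ | _ | _ = sorted nil i j k

applySgn : ∀ {m} → Sgn → Expr m → Expr m
applySgn plus  e = e
applySgn minus e = ⊝ e
applySgn nil   e = con 0ℤ

y : ∀ {m} → Fin m → Fin m → Fin m → Expr m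
y i j k with sort3 i j k
... | sorted s a b c = applySgn s (var a b c)

∂y : ∀ {m} → Fin m → Fin m → Fin m → Expr m → Expr m
∂y i j k P with sort3 i j k
... | sorted s a b c = applySgn s (D a b c P)

Σ : ∀ {m n} → (Fin n → Expr m) → Expr m
Σ {n = zero}  f = con 0ℤ
Σ {n = suc n} f = f zero ⊕ Σ (λ r → f (suc r))

signPow : ∀ {m} → ℕ → Expr m → Expr m
signPow zero          e = e
signPow (suc zero)    e = ⊝ e
signPow (suc (suc n)) e = signPow n e

Pf : ∀ {m n} → (Fin n → Fin n → Expr m) → Expr m
Pf {n = zero}        A = con 1ℤ
Pf {n = suc zero}    A = con 0ℤ
Pf {n = suc (suc n)} A =
  Σ (λ (j : Fin (suc n)) →
    signPow (toℕ j)
      (A zero (suc j) ⊗ Pf (λ r s → A (suc (punchIn j r)) (suc (punchIn j s)))))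

Λ : ∀ {m} → Fin m → Fin m → Expr m
Λ i j = Σ (λ k → y i j k)

Λ⁽_⁾ : ∀ {m} → Fin (suc m) → Fin m → Fin m → Expr (suc m)
Λ⁽ p ⁾ r s = Λ (punchIn p r) (punchIn p s)

-- Pfaffian-tree polynomial  P_m = (-1)^{p-1} Pf(Λ^{(p)}), taken with p = 1.
𝒫 : (m : ℕ) → Expr m
𝒫 zero    = con 0ℤ   -- never used (m = 0 has no row to delete)
𝒫 (suc m) = Pf (Λ⁽ zero ⁾)

{-# OPTIONS --safe #-}
-- Each ∂/∂y_ijk followed by evaluation at a point ρ is a derivation ℤ[y] → ℤ, and so is
-- Q = (∂_ijk − ∂_ijl) − (∂_jkl − ∂_ikl). As 𝒫_m is a polynomial in the entries λ_ab of Λ, it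
-- suffices that Q kills every λ_ab. Now ∂y_abc/∂y_ijk is the generalised Kronecker delta δ^{abc}_{ijk}
-- (both are alternating in ijk and in abc, and they agree on increasing triples), so
-- ∂λ_ab/∂y_ijk = Σ_c δ^{abc}_{ijk} = ω_ij + ω_jk + ω_ki with ω_pq = δ^{ab}_{pq} antisymmetric.
-- Then Q λ_ab is the simplicial coboundary applied twice to ω, hence zero.
module Submission where

open import Defs
open import Data.Nat using (ℕ; zero; suc)
open import Data.Fin using (Fin; zero; suc; _<_; _<?_; toℕ; punchIn)
open import Data.Fin.Properties using (_≟_; <-asym; <-trans; ≤∧≢⇒<)
import Data.Nat.Properties as ℕ
open import Data.Integer using (ℤ; 0ℤ; 1ℤ; _+_; _*_; -_; _-_)
open import Data.Integer.Properties
  using (+-*-semiring; +-identityˡ; *-identityʳ; *-zeroʳ; +-inverseˡ; neg-distrib-+; i-j≡0⇒i≡j)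
open import Data.Integer.Tactic.RingSolver using (solve-∀)
open import Algebra.Properties.Semiring.Sum +-*-semiring
  using (sum; sum-cong-≗; sum-replicate-zero; ∑-distrib-+; *-distribˡ-sum)
open import Data.Bool using (if_then_else_)
open import Function using (_∘_)
open import Data.Sum using (_⊎_; inj₁; inj₂)
open import Data.Empty using (⊥-elim)
open import Relation.Nullary using (yes; no; ¬_; does)
open import Relation.Binary.PropositionalEquality
  using (_≡_; _≢_; refl; sym; trans; cong; cong₂; module ≡-Reasoning)

open ≡-Reasoning

cyclicSum : ∀ {A : Set} → (A → A → ℤ) → A → A → A → ℤ
cyclicSum ω i j k = ω i j + ω j k + ω k i

cyclicSum-cocycle : ∀ {A : Set} (ω : A → A → ℤ) → (∀ p q → ω q p ≡ - ω p q) → ∀ i j k l →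
                    (cyclicSum ω i j k - cyclicSum ω i j l) - (cyclicSum ω j k l - cyclicSum ω i k l) ≡ 0ℤ
cyclicSum-cocycle ω antisym i j k l = begin
  (cyclicSum ω i j k - cyclicSum ω i j l) - (cyclicSum ω j k l - cyclicSum ω i k l)
    ≡⟨ regroup (ω i j) (ω j k) (ω k i) (ω j l) (ω l i) (ω k l) (ω l j) (ω i k) ⟩
  (ω k i + ω i k) - (ω l j + ω j l) ≡⟨ cong₂ _-_ (cancel i k) (cancel j l) ⟩
  0ℤ - 0ℤ                           ∎
  where
  regroup : ∀ ij jk ki jl li kl lj ik →
    ((ij + jk + ki) - (ij + jl + li)) - ((jk + kl + lj) - (ik + kl + li)) ≡ (ki + ik) - (lj + jl)
  regroup = solve-∀
  cancel : ∀ p q → ω q p + ω p q ≡ 0ℤ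
  cancel p q = trans (cong (_+ ω p q) (antisym p q)) (+-inverseˡ (ω p q))

δ : ∀ {m} → Fin m → Fin m → ℤ
δ x y = if does (x ≟ y) then 1ℤ else 0ℤ

δ² : ∀ {m} → Fin m → Fin m → Fin m → Fin m → ℤ
δ² i j a b = δ i a * δ j b - δ i b * δ j a

-- The generalised Kronecker delta det (δ x y) (x ∈ i j k, y ∈ a b c), expanded along its last column.
δ³ : ∀ {m} → Fin m → Fin m → Fin m → Fin m → Fin m → Fin m → ℤ
δ³ i j k a b c = δ² i j a b * δ k c + δ² j k a b * δ i c + δ² k i a b * δ j c

sum-δ : ∀ {n} (x : Fin n) → sum (δ x) ≡ 1ℤ
sum-δ {suc n} zero    = cong (1ℤ +_) (sum-replicate-zero n)
sum-δ {suc n} (suc x) = trans (+-identityˡ _) (sum-δ x)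

δ²-antisym : ∀ {m} (i j a b : Fin m) → δ² j i a b ≡ - δ² i j a b
δ²-antisym i j a b = antisym (δ i a) (δ i b) (δ j a) (δ j b)
  where
  antisym : ∀ ia ib ja jb → ja * ib - jb * ia ≡ - (ia * jb - ib * ja)
  antisym = solve-∀

δ-crossing : ∀ {m} {x y u v : Fin m} → x < y → u < v → δ x v * δ y u ≡ 0ℤ
δ-crossing {x = x} {y} {u} {v} x<y u<v with x ≟ v | y ≟ u
... | yes refl | yes refl = ⊥-elim (<-asym x<y u<v)
... | yes _    | no _     = refl
... | no _     | yes _    = refl
... | no _     | no _     = refl

sum-*δ : ∀ {n} (X : ℤ) (x : Fin n) → sum (λ c → X * δ x c) ≡ X
sum-*δ X x = trans (sym (*-distribˡ-sum X (δ x))) (trans (cong (X *_) (sum-δ x)) (*-identityʳ X))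

sum-δ³ : ∀ {m} (i j k a b : Fin m) → sum (δ³ i j k a b) ≡ cyclicSum (λ p q → δ² p q a b) i j k
sum-δ³ i j k a b = begin
  sum (λ c → X * δ k c + Y * δ i c + Z * δ j c)
    ≡⟨ ∑-distrib-+ (λ c → X * δ k c + Y * δ i c) (λ c → Z * δ j c) ⟩
  sum (λ c → X * δ k c + Y * δ i c) + sum (λ c → Z * δ j c)
    ≡⟨ cong (_+ sum (λ c → Z * δ j c)) (∑-distrib-+ (λ c → X * δ k c) (λ c → Y * δ i c)) ⟩
  sum (λ c → X * δ k c) + sum (λ c → Y * δ i c) + sum (λ c → Z * δ j c)
    ≡⟨ cong₂ _+_ (cong₂ _+_ (sum-*δ X k) (sum-*δ Y i)) (sum-*δ Z j) ⟩
  X + Y + Z ∎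
  where
  X Y Z : ℤ
  X = δ² i j a b
  Y = δ² j k a b
  Z = δ² k i a b

record Alternating {m} (F : Fin m → Fin m → Fin m → ℤ) : Set where
  field
    swap₁₂ : ∀ i j k → F j i k ≡ - F i j k
    rotate : ∀ i j k → F j k i ≡ F i j k
    diag₁₂ : ∀ i k → F i i k ≡ 0ℤ

  swap₂₃ : ∀ i j k → F i k j ≡ - F i j k
  swap₂₃ i j k = trans (sym (rotate i k j)) (trans (sym (rotate k j i)) (swap₁₂ i j k))

  swap₁₃ : ∀ i j k → F k j i ≡ - F i j k
  swap₁₃ i j k = trans (rotate i k j) (swap₂₃ i j k)

  diag₂₃ : ∀ i j → F i j j ≡ 0ℤ
  diag₂₃ i j = trans (sym (rotate i j j)) (diag₁₂ j i)

  diag₁₃ : ∀ i j → F i j i ≡ 0ℤ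
  diag₁₃ i j = trans (sym (rotate i j i)) (diag₂₃ j i)

-- Mirrors applySgn: eval ρ (applySgn s e) computes to ⟦ s ⟧ˢ (eval ρ e).
⟦_⟧ˢ : Sgn → ℤ → ℤ
⟦ plus  ⟧ˢ x = x
⟦ minus ⟧ˢ x = - x
⟦ nil   ⟧ˢ x = 0ℤ

signed : ∀ {m} → (Fin m → Fin m → Fin m → ℤ) → Sorted m → ℤ
signed F (sorted s p q r) = ⟦ s ⟧ˢ (F p q r)

data SortView {m} (i j k : Fin m) : Sorted m → Set where
  v123 : i < j → j < k → SortView i j k (sorted plus  i j k)
  v132 : i < k → k < j → SortView i j k (sorted minus i k j)
  v312 : k < i → i < j → SortView i j k (sorted plus  k i j)
  v213 : j < i → i < k → SortView i j k (sorted minus j i k)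
  v231 : j < k → k < i → SortView i j k (sorted plus  j k i)
  v321 : k < j → j < i → SortView i j k (sorted minus k j i)
  vnil : i ≡ j ⊎ j ≡ k ⊎ i ≡ k → SortView i j k (sorted nil i j k)

≢∧≮⇒> : ∀ {m} {x y : Fin m} → x ≢ y → ¬ x < y → y < x
≢∧≮⇒> x≢y x≮y = ≤∧≢⇒< (ℕ.≮⇒≥ x≮y) (λ y≡x → x≢y (sym y≡x))

sortView : ∀ {m} (i j k : Fin m) → SortView i j k (sort3 i j k)
sortView i j k with i ≟ j | j ≟ k | i ≟ k
... | yes i≡j | _       | _       = vnil (inj₁ i≡j)
... | no _    | yes j≡k | _       = vnil (inj₂ (inj₁ j≡k))
... | no _    | no _    | yes i≡k = vnil (inj₂ (inj₂ i≡k))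
... | no i≢j  | no j≢k  | no i≢k with i <? j | j <? k | i <? k
...   | yes i<j | yes j<k | _       = v123 i<j j<k
...   | yes i<j | no j≮k  | yes i<k = v132 i<k (≢∧≮⇒> j≢k j≮k)
...   | yes i<j | no _    | no i≮k  = v312 (≢∧≮⇒> i≢k i≮k) i<j
...   | no i≮j  | yes _   | yes i<k = v213 (≢∧≮⇒> i≢j i≮j) i<k
...   | no _    | yes j<k | no i≮k  = v231 j<k (≢∧≮⇒> i≢k i≮k)
...   | no i≮j  | no j≮k  | _       = v321 (≢∧≮⇒> j≢k j≮k) (≢∧≮⇒> i≢j i≮j)

module _ {m} {F : Fin m → Fin m → Fin m → ℤ} (alt : Alternating F) where
  open Alternating alt

  alternating-sort : ∀ i j k → F i j k ≡ signed F (sort3 i j k)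
  alternating-sort i j k with sort3 i j k | sortView i j k
  ... | _ | v123 _ _ = refl
  ... | _ | v132 _ _ = swap₂₃ i k j
  ... | _ | v312 _ _ = rotate k i j
  ... | _ | v213 _ _ = swap₁₂ j i k
  ... | _ | v231 _ _ = sym (rotate i j k)
  ... | _ | v321 _ _ = swap₁₃ k j i
  ... | _ | vnil (inj₁ refl)        = diag₁₂ i k
  ... | _ | vnil (inj₂ (inj₁ refl)) = diag₂₃ i j
  ... | _ | vnil (inj₂ (inj₂ refl)) = diag₁₃ i j

signed-cong-increasing : ∀ {m} {F G : Fin m → Fin m → Fin m → ℤ} →
                         (∀ {p q r} → p < q → q < r → F p q r ≡ G p q r) →
                         ∀ i j k → signed F (sort3 i j k) ≡ signed G (sort3 i j k)
signed-cong-increasing F≡G i j k with sort3 i j k | sortView i j k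
... | _ | v123 i<j j<k = F≡G i<j j<k
... | _ | v132 i<k k<j = cong -_ (F≡G i<k k<j)
... | _ | v312 k<i i<j = F≡G k<i i<j
... | _ | v213 j<i i<k = cong -_ (F≡G j<i i<k)
... | _ | v231 j<k k<i = F≡G j<k k<i
... | _ | v321 k<j j<i = cong -_ (F≡G k<j j<i)
... | _ | vnil _       = refl

δ³-rows : ∀ {m} (a b c : Fin m) → Alternating (λ i j k → δ³ i j k a b c)
δ³-rows a b c = record
  { swap₁₂ = λ i j k → swap (δ i a) (δ i b) (δ i c) (δ j a) (δ j b) (δ j c) (δ k a) (δ k b) (δ k c)
  ; rotate = λ i j k → rotate (δ i a) (δ i b) (δ i c) (δ j a) (δ j b) (δ j c) (δ k a) (δ k b) (δ k c)
  ; diag₁₂ = λ i k → diag (δ i a) (δ i b) (δ i c) (δ k a) (δ k b) (δ k c)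
  }
  where
  swap : ∀ ia ib ic ja jb jc ka kb kc →
    (ja * ib - jb * ia) * kc + (ia * kb - ib * ka) * jc + (ka * jb - kb * ja) * ic ≡
    - ((ia * jb - ib * ja) * kc + (ja * kb - jb * ka) * ic + (ka * ib - kb * ia) * jc)
  swap = solve-∀
  rotate : ∀ ia ib ic ja jb jc ka kb kc →
    (ja * kb - jb * ka) * ic + (ka * ib - kb * ia) * jc + (ia * jb - ib * ja) * kc ≡
    (ia * jb - ib * ja) * kc + (ja * kb - jb * ka) * ic + (ka * ib - kb * ia) * jc
  rotate = solve-∀
  diag : ∀ ia ib ic ka kb kc →
    (ia * ib - ib * ia) * kc + (ia * kb - ib * ka) * ic + (ka * ib - kb * ia) * ic ≡ 0ℤ
  diag = solve-∀

δ³-columns : ∀ {m} (i j k : Fin m) → Alternating (δ³ i j k)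
δ³-columns i j k = record
  { swap₁₂ = λ a b c → swap (δ i a) (δ i b) (δ i c) (δ j a) (δ j b) (δ j c) (δ k a) (δ k b) (δ k c)
  ; rotate = λ a b c → rotate (δ i a) (δ i b) (δ i c) (δ j a) (δ j b) (δ j c) (δ k a) (δ k b) (δ k c)
  ; diag₁₂ = λ a c → diag (δ i a) (δ i c) (δ j a) (δ j c) (δ k a) (δ k c)
  }
  where
  swap : ∀ ia ib ic ja jb jc ka kb kc →
    (ib * ja - ia * jb) * kc + (jb * ka - ja * kb) * ic + (kb * ia - ka * ib) * jc ≡
    - ((ia * jb - ib * ja) * kc + (ja * kb - jb * ka) * ic + (ka * ib - kb * ia) * jc)
  swap = solve-∀
  rotate : ∀ ia ib ic ja jb jc ka kb kc →
    (ib * jc - ic * jb) * ka + (jb * kc - jc * kb) * ia + (kb * ic - kc * ib) * ja ≡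
    (ia * jb - ib * ja) * kc + (ja * kb - jb * ka) * ic + (ka * ib - kb * ia) * jc
  rotate = solve-∀
  diag : ∀ ia ic ja jc ka kc →
    (ia * ja - ia * ja) * kc + (ja * ka - ja * ka) * ic + (ka * ia - ka * ia) * jc ≡ 0ℤ
  diag = solve-∀

δ³-diagonal : ∀ {m} {p q r : Fin m} → p < q → q < r → ∀ {a b c} → a < b → b < c →
              δ³ p q r a b c ≡ δ p a * δ q b * δ r c
δ³-diagonal {p = p} {q} {r} p<q q<r {a} {b} {c} a<b b<c =
  trans (regroup (δ p a) (δ p b) (δ p c) (δ q a) (δ q b) (δ q c) (δ r a) (δ r b) (δ r c))
        (vanish (δ r c) (δ r b) (δ r a) (δ q c) (δ p a)
              (δ-crossing p<q a<b) (δ-crossing p<q a<c) (δ-crossing p<q b<c)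
              (δ-crossing p<r a<b) (δ-crossing q<r b<c))
  where
  p<r : p < r
  p<r = <-trans p<q q<r
  a<c : a < c
  a<c = <-trans a<b b<c
  -- Every off-diagonal term contains a crossing pair δ x v * δ y u with x < y and u < v.
  regroup : ∀ pa pb pc qa qb qc ra rb rc →
    (pa * qb - pb * qa) * rc + (qa * rb - qb * ra) * pc + (ra * pb - rb * pa) * qc ≡
    pa * qb * rc - pb * qa * rc + pc * qa * rb - pc * qb * ra + pb * ra * qc - qc * rb * pa
  regroup = solve-∀
  vanish : ∀ {d x₁ x₂ x₃ x₄ x₅} y₁ y₂ y₃ y₄ y₅ → x₁ ≡ 0ℤ → x₂ ≡ 0ℤ → x₃ ≡ 0ℤ → x₄ ≡ 0ℤ → x₅ ≡ 0ℤ →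
         d - x₁ * y₁ + x₂ * y₂ - x₃ * y₃ + x₄ * y₄ - x₅ * y₅ ≡ d
  vanish {d} _ _ _ _ _ refl refl refl refl refl = zeros d
    where
    zeros : ∀ d → d - 0ℤ + 0ℤ - 0ℤ + 0ℤ - 0ℤ ≡ d
    zeros = solve-∀

module _ {m} (ρ : Fin m → Fin m → Fin m → ℤ) where

  record IsDerivation (d : Expr m → ℤ) : Set where
    field
      constant : ∀ x → d (con x) ≡ 0ℤ
      additive : ∀ e f → d (e ⊕ f) ≡ d e + d f
      leibniz  : ∀ e f → d (e ⊗ f) ≡ d e * eval ρ f + eval ρ e * d f
      negation : ∀ e → d (⊝ e) ≡ - d e

  0-isDerivation : IsDerivation (λ _ → 0ℤ)
  0-isDerivation = record
    { constant = λ _ → refl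
    ; additive = λ _ _ → refl
    ; leibniz  = λ e f → sym (trans (+-identityˡ _) (*-zeroʳ (eval ρ e)))
    ; negation = λ _ → refl
    }

  neg-isDerivation : ∀ {d} → IsDerivation d → IsDerivation (λ e → - d e)
  neg-isDerivation {d} isD = record
    { constant = λ x → cong -_ (constant x)
    ; additive = λ e f → trans (cong -_ (additive e f)) (neg-distrib-+ (d e) (d f))
    ; leibniz  = λ e f → trans (cong -_ (leibniz e f)) (neg-leibniz (d e) (d f) (eval ρ e) (eval ρ f))
    ; negation = λ e → cong -_ (negation e)
    }
    where
    open IsDerivation isD
    neg-leibniz : ∀ de df E F → - (de * F + E * df) ≡ - de * F + E * - df
    neg-leibniz = solve-∀

  minus-isDerivation : ∀ {d d′} → IsDerivation d → IsDerivation d′ → IsDerivation (λ e → d e - d′ e)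
  minus-isDerivation {d} {d′} isD isD′ = record
    { constant = λ x → cong₂ _-_ (L.constant x) (R.constant x)
    ; additive = λ e f → trans (cong₂ _-_ (L.additive e f) (R.additive e f)) (minus-additive (d e) (d f) (d′ e) (d′ f))
    ; leibniz  = λ e f → trans (cong₂ _-_ (L.leibniz e f) (R.leibniz e f))
                                (minus-leibniz (d e) (d f) (d′ e) (d′ f) (eval ρ e) (eval ρ f))
    ; negation = λ e → trans (cong₂ _-_ (L.negation e) (R.negation e)) (minus-negation (d e) (d′ e))
    }
    where
    module L = IsDerivation isD
    module R = IsDerivation isD′
    minus-additive : ∀ de df de′ df′ → (de + df) - (de′ + df′) ≡ (de - de′) + (df - df′)
    minus-additive = solve-∀
    minus-leibniz : ∀ de df de′ df′ E F →
      (de * F + E * df) - (de′ * F + E * df′) ≡ (de - de′) * F + E * (df - df′)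
    minus-leibniz = solve-∀
    minus-negation : ∀ de de′ → - de - - de′ ≡ - (de - de′)
    minus-negation = solve-∀

  D-isDerivation : ∀ p q r → IsDerivation (λ e → eval ρ (D p q r e))
  D-isDerivation p q r = record
    { constant = λ _ → refl
    ; additive = λ _ _ → refl
    ; leibniz  = λ _ _ → refl
    ; negation = λ _ → refl
    }

  ∂y-isDerivation : ∀ i j k → IsDerivation (λ e → eval ρ (∂y i j k e))
  ∂y-isDerivation i j k with sort3 i j k
  ... | sorted plus  p q r = D-isDerivation p q r
  ... | sorted minus p q r = neg-isDerivation (D-isDerivation p q r)
  ... | sorted nil   p q r = 0-isDerivation

  module _ {d : Expr m → ℤ} (isD : IsDerivation d) where
    open IsDerivation isD

    derivation-Σ : ∀ {n} (f : Fin n → Expr m) → d (Σ f) ≡ sum (λ c → d (f c))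
    derivation-Σ {zero}  f = constant 0ℤ
    derivation-Σ {suc n} f = trans (additive (f zero) (Σ (f ∘ suc))) (cong (d (f zero) +_) (derivation-Σ (f ∘ suc)))

    kills-Σ : ∀ {n} {f : Fin n → Expr m} → (∀ c → d (f c) ≡ 0ℤ) → d (Σ f) ≡ 0ℤ
    kills-Σ {n} {f} df≡0 = trans (derivation-Σ f) (trans (sum-cong-≗ df≡0) (sum-replicate-zero n))

    kills-signPow : ∀ n {e} → d e ≡ 0ℤ → d (signPow n e) ≡ 0ℤ
    kills-signPow zero          de≡0 = de≡0
    kills-signPow (suc zero)    de≡0 = trans (negation _) (cong -_ de≡0)
    kills-signPow (suc (suc n)) de≡0 = kills-signPow n de≡0

    kills-⊗ : ∀ {e f} → d e ≡ 0ℤ → d f ≡ 0ℤ → d (e ⊗ f) ≡ 0ℤ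
    kills-⊗ {e} {f} de≡0 df≡0 = begin
      d (e ⊗ f)                       ≡⟨ leibniz e f ⟩
      d e * eval ρ f + eval ρ e * d f ≡⟨ cong₂ (λ x y → x * eval ρ f + eval ρ e * y) de≡0 df≡0 ⟩
      0ℤ * eval ρ f + eval ρ e * 0ℤ   ≡⟨ cong (0ℤ +_) (*-zeroʳ (eval ρ e)) ⟩
      0ℤ                              ∎

    kills-Pf : ∀ {n} (A : Fin n → Fin n → Expr m) → (∀ r s → d (A r s) ≡ 0ℤ) → d (Pf A) ≡ 0ℤ
    kills-Pf {zero}        A _    = constant 1ℤ
    kills-Pf {suc zero}    A _    = constant 0ℤ
    kills-Pf {suc (suc n)} A dA≡0 = kills-Σ λ j →
      kills-signPow (toℕ j) (kills-⊗ (dA≡0 zero (suc j))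
        (kills-Pf _ (λ r s → dA≡0 (suc (punchIn j r)) (suc (punchIn j s)))))

  eval-D-applySgn : ∀ s p q r e → eval ρ (D p q r (applySgn s e)) ≡ ⟦ s ⟧ˢ (eval ρ (D p q r e))
  eval-D-applySgn plus  p q r e = refl
  eval-D-applySgn minus p q r e = refl
  eval-D-applySgn nil   p q r e = refl

  eval-∂y : ∀ i j k e → eval ρ (∂y i j k e) ≡ signed (λ p q r → eval ρ (D p q r e)) (sort3 i j k)
  eval-∂y i j k e with sort3 i j k
  ... | sorted plus  p q r = refl
  ... | sorted minus p q r = refl
  ... | sorted nil   p q r = refl

  eval-D-var : ∀ p q r a b c → eval ρ (D p q r (var a b c)) ≡ δ p a * δ q b * δ r c
  eval-D-var p q r a b c with p ≟ a | q ≟ b | r ≟ c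
  ... | yes _ | yes _ | yes _ = refl
  ... | yes _ | yes _ | no _  = refl
  ... | yes _ | no _  | _     = refl
  ... | no _  | _     | _     = refl

  eval-D-y : ∀ p q r a b c → eval ρ (D p q r (y a b c)) ≡ signed (λ a b c → δ p a * δ q b * δ r c) (sort3 a b c)
  eval-D-y p q r a b c with sort3 a b c
  ... | sorted s a′ b′ c′ = trans (eval-D-applySgn s p q r (var a′ b′ c′)) (cong ⟦ s ⟧ˢ (eval-D-var p q r a′ b′ c′))

  eval-D-y-increasing : ∀ a b c {p q r} → p < q → q < r → eval ρ (D p q r (y a b c)) ≡ δ³ p q r a b c
  eval-D-y-increasing a b c {p} {q} {r} p<q q<r = begin
    eval ρ (D p q r (y a b c))                              ≡⟨ eval-D-y p q r a b c ⟩
    signed (λ a b c → δ p a * δ q b * δ r c) (sort3 a b c)  ≡⟨ signed-cong-increasing (δ³-diagonal p<q q<r) a b c ⟨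
    signed (δ³ p q r) (sort3 a b c)                         ≡⟨ alternating-sort (δ³-columns p q r) a b c ⟨
    δ³ p q r a b c                                          ∎

  eval-∂y-y : ∀ i j k a b c → eval ρ (∂y i j k (y a b c)) ≡ δ³ i j k a b c
  eval-∂y-y i j k a b c = begin
    eval ρ (∂y i j k (y a b c))                                  ≡⟨ eval-∂y i j k (y a b c) ⟩
    signed (λ p q r → eval ρ (D p q r (y a b c))) (sort3 i j k)  ≡⟨ signed-cong-increasing (eval-D-y-increasing a b c) i j k ⟩
    signed (λ p q r → δ³ p q r a b c) (sort3 i j k)              ≡⟨ alternating-sort (δ³-rows a b c) i j k ⟨
    δ³ i j k a b c                                               ∎

  eval-∂y-Λ : ∀ i j k a b → eval ρ (∂y i j k (Λ a b)) ≡ cyclicSum (λ p q → δ² p q a b) i j k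
  eval-∂y-Λ i j k a b = begin
    eval ρ (∂y i j k (Λ a b))                  ≡⟨ derivation-Σ (∂y-isDerivation i j k) (y a b) ⟩
    sum (λ c → eval ρ (∂y i j k (y a b c)))    ≡⟨ sum-cong-≗ (eval-∂y-y i j k a b) ⟩
    sum (δ³ i j k a b)                         ≡⟨ sum-δ³ i j k a b ⟩
    cyclicSum (λ p q → δ² p q a b) i j k       ∎

  ∂y-coboundary : Fin m → Fin m → Fin m → Fin m → Expr m → ℤ
  ∂y-coboundary i j k l e = (eval ρ (∂y i j k e) - eval ρ (∂y i j l e)) - (eval ρ (∂y j k l e) - eval ρ (∂y i k l e))

  ∂y-coboundary-isDerivation : ∀ i j k l → IsDerivation (∂y-coboundary i j k l)
  ∂y-coboundary-isDerivation i j k l =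
    minus-isDerivation (minus-isDerivation (∂y-isDerivation i j k) (∂y-isDerivation i j l))
                       (minus-isDerivation (∂y-isDerivation j k l) (∂y-isDerivation i k l))

  ∂y-coboundary-kills-Λ : ∀ i j k l a b → ∂y-coboundary i j k l (Λ a b) ≡ 0ℤ
  ∂y-coboundary-kills-Λ i j k l a b = begin
    ∂y-coboundary i j k l (Λ a b)
      ≡⟨ cong₂ _-_ (cong₂ _-_ (eval-∂y-Λ i j k a b) (eval-∂y-Λ i j l a b))
                   (cong₂ _-_ (eval-∂y-Λ j k l a b) (eval-∂y-Λ i k l a b)) ⟩
    (cyclicSum ω i j k - cyclicSum ω i j l) - (cyclicSum ω j k l - cyclicSum ω i k l)
      ≡⟨ cyclicSum-cocycle ω (λ p q → δ²-antisym p q a b) i j k l ⟩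
    0ℤ ∎
    where
    ω : Fin m → Fin m → ℤ
    ω p q = δ² p q a b

kills-𝒫 : ∀ m {ρ : Fin m → Fin m → Fin m → ℤ} {d : Expr m → ℤ} → IsDerivation ρ d →
          (∀ a b → d (Λ a b) ≡ 0ℤ) → d (𝒫 m) ≡ 0ℤ
kills-𝒫 zero    isD _    = IsDerivation.constant isD 0ℤ
kills-𝒫 (suc m) isD dΛ≡0 = kills-Pf _ isD (Λ⁽ zero ⁾) (λ r s → dΛ≡0 (suc r) (suc s))

-- The identity holds for arbitrary i j k l: with a repeated index both ∂y and δ³ vanish.
proposition6p9 : (m : ℕ) (i j k l : Fin m) →
    i ≢ j → i ≢ k → i ≢ l → j ≢ k → j ≢ l → k ≢ l →
    (∂y i j k (𝒫 m) ⊖ ∂y i j l (𝒫 m)) ≐ (∂y j k l (𝒫 m) ⊖ ∂y i k l (𝒫 m))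
proposition6p9 m i j k l _ _ _ _ _ _ ρ =
  i-j≡0⇒i≡j _ _ (kills-𝒫 m (∂y-coboundary-isDerivation ρ i j k l) (∂y-coboundary-kills-Λ ρ i j k l))
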